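{- Let $\mathbf h=(h_1,\ldots,h_n)\in\mathbb{N}_0^n$ be a primitive vector of $C^n$. Then: (i) for every integer $0\leq a\leq|\mathbf h|$ the level $S_a(\mathbf h)$ is nonempty, and for $a\neq 0,|\mathbf h|$ the level $S_a(\mathbf h)$ contains at least two elements; (ii) for every integer $g$ with $0\leq g\leq \frac{|\mathbf h|}{2}+1$, the vector $\mathbf g=(\mathbf h,g)\in\mathbb{N}_0^{n+1}$ is a primitive vector of $C^{n+1}$.
   Context: $C^n=\{ -1,1\}^n$. For $\mathbf h\in\mathbb{N}_0^n$ put $|\mathbf h|=\sum_i h_i$ and, for integers $0\le a\le|\mathbf h|$, the $a$-level $S_a(\mathbf h)=\{\mathbf v\in C^n:\mathbf h\cdot\mathbf v=|\mathbf h|-2a\}$. A signed rectangle of $C^n$ is $\pm(\{\mathbf u,\mathbf v\},\{\mathbf u',\mathbf v'\})$ with $\mathbf u,\mathbf v,\mathbf u',\mathbf v'$ four distinct vertices of $C^n$ with $\mathbf u+\mathbf v=\mathbf u'+\mathbf v'$ (a rectangle with diagonals $\mathbf u\mathbf v$, $\mathbf u'\mathbf v'$). An $\mathbf h$-rectangle is a sequence of integers $(a\le b\le c\le d)$ with $d=b+c-a$, $0\le a$, $d\le|\mathbf h|$; it is a 3-rectangle if $a<b=c<d$ and a 4-rectangle if $a<b<c<d$. It is realizable if there exist four distinct vertices $\mathbf v_a\in S_a(\mathbf h),\mathbf v_b\in S_b(\mathbf h),\mathbf v_c\in S_c(\mathbf h),\mathbf v_d\in S_d(\mathbf h)$ forming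 the signed rectangle $(\{\mathbf v_a,\mathbf v_d\},\{\mathbf v_b,\mathbf v_c\})$, i.e. $\mathbf v_a+\mathbf v_d=\mathbf v_b+\mathbf v_c$. The vector $\mathbf h$ is a primitive vector of $C^n$ if all its 3-rectangles and 4-rectangles are realizable. -}

module Defs where

open import Data.Nat as ℕ using (ℕ; zero; suc; _≤_; _<_)
open import Data.Integer as ℤ using (ℤ; +_)
open import Data.Bool using (Bool; true; false)
open import Data.Vec using (Vec; []; _∷_; zipWith; foldr)
open import Data.Product using (_×_; ∃; ∃-syntax)
open import Relation.Binary.PropositionalEquality using (_≡_; _≢_)

-- A vertex of the cube C^n = {-1,1}^n, encoded by a Bool vector:
-- true ↦ +1, false ↦ -1.
Vertex : ℕ → Set
Vertex n = Vec Bool n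

sgn : Bool → ℤ
sgn true  = + 1
sgn false = ℤ.- (+ 1)

coords : ∀ {n} → Vertex n → Vec ℤ n
coords []       = []
coords (b ∷ bs) = sgn b ∷ coords bs

norm : ∀ {n} → Vec ℕ n → ℕ
norm []       = 0
norm (x ∷ xs) = x ℕ.+ norm xs

dot : ∀ {n} → Vec ℕ n → Vertex n → ℤ
dot []       []       = + 0
dot (x ∷ xs) (b ∷ bs) = (+ x) ℤ.* sgn b ℤ.+ dot xs bs

InLevel : ∀ {n} → Vec ℕ n → ℕ → Vertex n → Set
InLevel h a v = dot h v ≡ (+ norm h) ℤ.- (+ (2 ℕ.* a))

vsum : ∀ {n} → Vertex n → Vertex n → Vec ℤ n
vsum u v = zipWith ℤ._+_ (coords u) (coords v)

Distinct4 : ∀ {n} → Vertex n → Vertex n → Vertex n → Vertex n → Set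
Distinct4 p q r s =
  p ≢ q × p ≢ r × p ≢ s × q ≢ r × q ≢ s × r ≢ s

Realizable : ∀ {n} → Vec ℕ n → ℕ → ℕ → ℕ → ℕ → Set
Realizable {n} h a b c d =
  ∃[ va ] ∃[ vb ] ∃[ vc ] ∃[ vd ]
    (InLevel h a va × InLevel h b vb × InLevel h c vc × InLevel h d vd
     × Distinct4 va vb vc vd
     × vsum va vd ≡ vsum vb vc)

Is3Rect : ∀ {n} → Vec ℕ n → ℕ → ℕ → ℕ → ℕ → Set
Is3Rect h a b c d = a < b × b ≡ c × c < d × d ℕ.+ a ≡ b ℕ.+ c × d ≤ norm h

Is4Rect : ∀ {n} → Vec ℕ n → ℕ → ℕ → ℕ → ℕ → Set
Is4Rect h a b c d = a < b × b < c × c < d × d ℕ.+ a ≡ b ℕ.+ c × d ≤ norm h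

Primitive : ∀ {n} → Vec ℕ n → Set
Primitive h =
  (∀ a b c d → Is3Rect h a b c d → Realizable h a b c d) ×
  (∀ a b c d → Is4Rect h a b c d → Realizable h a b c d)

-- Primitivity realizes the 3-rectangle (a-1, a, a, a+1), which puts two vertices on every inner
-- level. For a rectangle (a, b, c, d) of (h, g): if d ≤ |h| it lifts from h with last coordinates
-- +1; if g ≤ a it lifts from (a-g, b-g, c-g, d-g) with last coordinates -1; otherwise
-- 2g ≤ |h| + 2 forces g ≤ c and b ≤ |h|, and it lifts from the quadruple (a, b, c-g, d-g) with
-- last coordinates (+1, +1, -1, -1). That quadruple need be neither ordered nor nondegenerate, but
-- up to the symmetries of a rectangle it is either realizable in h or collapses to two vertices
-- counted twice, since all levels are nonempty.

module Submission where

open import Defs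
open import Data.Nat using (ℕ; zero; suc; _+_; _*_; _∸_; _≤_; _<_; z≤n; s≤s; _≤?_; _≟_)
open import Data.Nat.Properties
open import Data.Integer as ℤ using (ℤ; +_)
import Data.Integer.Properties as ℤ
import Data.Integer.Tactic.RingSolver as ℤ-Solver
open import Algebra.Properties.AbelianGroup ℤ.+-0-abelianGroup using (∙-cancelˡ)
open import Algebra.Properties.CommutativeSemigroup +-commutativeSemigroup
  using (x∙yz≈y∙xz; xy∙z≈xz∙y)
open import Data.Bool using (Bool; true; false)
open import Data.Vec using (Vec; []; _∷_; _∷ʳ_; replicate)
open import Data.Vec.Properties using (zipWith-comm; ∷ʳ-injectiveˡ; ∷ʳ-injectiveʳ)
open import Data.Product using (_×_; _,_; proj₁; proj₂; Σ-syntax; ∃-syntax; map₂)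
open import Data.Sum using (inj₁; inj₂)
open import Relation.Binary.PropositionalEquality
  using (_≡_; _≢_; refl; sym; trans; cong; cong₂; subst; module ≡-Reasoning)
open import Relation.Nullary using (yes; no; contradiction)

private
  variable
    n : ℕ
    a b c d g p q r s : ℕ

weight : ℕ → Bool → ℕ
weight x true  = 0
weight x false = x

-- level h v is the a with v ∈ S_a(h): the total weight of the coordinates where v is -1.
level : Vec ℕ n → Vertex n → ℕ
level []      []      = 0
level (x ∷ h) (b ∷ v) = weight x b + level h v

dot-level : (h : Vec ℕ n) (v : Vertex n) → dot h v ≡ + norm h ℤ.- + (2 * level h v)
dot-level []      []      = refl
dot-level (x ∷ h) (b ∷ v) = begin
  + x ℤ.* sgn b ℤ.+ dot h v
    ≡⟨ cong (ℤ._+_ (+ x ℤ.* sgn b)) (dot-level h v) ⟩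
  + x ℤ.* sgn b ℤ.+ (+ norm h ℤ.- + (2 * level h v))
    ≡⟨ cong (λ t → + x ℤ.* sgn b ℤ.+ (+ norm h ℤ.- t)) (ℤ.pos-* 2 (level h v)) ⟩
  + x ℤ.* sgn b ℤ.+ (+ norm h ℤ.- + 2 ℤ.* + level h v)
    ≡⟨ coordinate-identity b x (+ norm h) (+ level h v) ⟩
  (+ x ℤ.+ + norm h) ℤ.- + 2 ℤ.* (+ weight x b ℤ.+ + level h v)
    ≡⟨ cong₂ ℤ._-_ (sym (ℤ.pos-+ x (norm h)))
         (trans (cong (+ 2 ℤ.*_) (sym (ℤ.pos-+ (weight x b) (level h v))))
                (sym (ℤ.pos-* 2 (weight x b + level h v)))) ⟩
  + norm (x ∷ h) ℤ.- + (2 * level (x ∷ h) (b ∷ v))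
    ∎
  where
  open ≡-Reasoning
  coordinate-identity : ∀ b x (N L : ℤ) →
    + x ℤ.* sgn b ℤ.+ (N ℤ.- + 2 ℤ.* L) ≡ (+ x ℤ.+ N) ℤ.- + 2 ℤ.* (+ weight x b ℤ.+ L)
  coordinate-identity true  x = solve (+ x)
    where
    solve : ∀ (x N L : ℤ) → x ℤ.* + 1 ℤ.+ (N ℤ.- + 2 ℤ.* L) ≡ (x ℤ.+ N) ℤ.- + 2 ℤ.* (+ 0 ℤ.+ L)
    solve = ℤ-Solver.solve-∀
  coordinate-identity false x = solve (+ x)
    where
    solve : ∀ (x N L : ℤ) → x ℤ.* ℤ.- + 1 ℤ.+ (N ℤ.- + 2 ℤ.* L) ≡ (x ℤ.+ N) ℤ.- + 2 ℤ.* (x ℤ.+ L)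
    solve = ℤ-Solver.solve-∀

level⇒InLevel : (h : Vec ℕ n) {v : Vertex n} → level h v ≡ a → InLevel h a v
level⇒InLevel h {v} refl = dot-level h v

InLevel⇒level : (h : Vec ℕ n) {v : Vertex n} → InLevel h a v → level h v ≡ a
InLevel⇒level {a = a} h {v} v∈Sa =
  *-cancelˡ-≡ (level h v) a 2
    (ℤ.+-injective (ℤ.neg-injective
      (∙-cancelˡ (+ norm h) _ _ (trans (sym (dot-level h v)) v∈Sa))))

level-replicate-true : (h : Vec ℕ n) → level h (replicate n true) ≡ 0
level-replicate-true []      = refl
level-replicate-true (x ∷ h) = level-replicate-true h

level-replicate-false : (h : Vec ℕ n) → level h (replicate n false) ≡ norm h
level-replicate-false []      = refl
level-replicate-false (x ∷ h) = cong (_+_ x) (level-replicate-false h)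

level-∷ʳ : (h : Vec ℕ n) (v : Vertex n) (g : ℕ) (s : Bool) →
           level (h ∷ʳ g) (v ∷ʳ s) ≡ level h v + weight g s
level-∷ʳ []      []      g s = +-identityʳ (weight g s)
level-∷ʳ (x ∷ h) (b ∷ v) g s =
  trans (cong (_+_ (weight x b)) (level-∷ʳ h v g s)) (sym (+-assoc (weight x b) (level h v) _))

norm-∷ʳ : (h : Vec ℕ n) (g : ℕ) → norm (h ∷ʳ g) ≡ g + norm h
norm-∷ʳ []      g = refl
norm-∷ʳ (x ∷ h) g = trans (cong (_+_ x) (norm-∷ʳ h g)) (x∙yz≈y∙xz x g (norm h))

different-levels⇒≢ : (h : Vec ℕ n) {u v : Vertex n} → level h u ≡ a → level h v ≡ b → a ≢ b → u ≢ v
different-levels⇒≢ h lu lv a≢b refl = a≢b (trans (sym lu) lv)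

vsum-comm : (u v : Vertex n) → vsum u v ≡ vsum v u
vsum-comm u v = zipWith-comm ℤ.+-comm (coords u) (coords v)

vsum-∷ʳ : (u v : Vertex n) (s t : Bool) → vsum (u ∷ʳ s) (v ∷ʳ t) ≡ vsum u v ∷ʳ (sgn s ℤ.+ sgn t)
vsum-∷ʳ []      []      s t = refl
vsum-∷ʳ (x ∷ u) (y ∷ v) s t = cong ((sgn x ℤ.+ sgn y) ∷_) (vsum-∷ʳ u v s t)

-- Realizability without the requirement that the four vertices be distinct.
record Rect (h : Vec ℕ n) (a b c d : ℕ) : Set where
  constructor rect
  field
    va vb vc vd : Vertex n
    level-va : level h va ≡ a
    level-vb : level h vb ≡ b
    level-vc : level h vc ≡ c
    level-vd : level h vd ≡ d
    diagonals : vsum va vd ≡ vsum vb vc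

open Rect

module _ {h : Vec ℕ n} where

  Rect-swapOuter : Rect h a b c d → Rect h d b c a
  Rect-swapOuter (rect va vb vc vd la lb lc ld e) =
    rect vd vb vc va ld lb lc la (trans (vsum-comm vd va) e)

  Rect-swapInner : Rect h a b c d → Rect h a c b d
  Rect-swapInner (rect va vb vc vd la lb lc ld e) =
    rect va vc vb vd la lc lb ld (trans e (vsum-comm vb vc))

  Rect-swapDiagonals : Rect h a b c d → Rect h b a d c
  Rect-swapDiagonals (rect va vb vc vd la lb lc ld e) = rect vb va vd vc lb la ld lc (sym e)

  Realizable⇒Rect : Realizable h a b c d → Σ[ r ∈ Rect h a b c d ] vb r ≢ vc r
  Realizable⇒Rect (va , vb , vc , vd , la , lb , lc , ld , (_ , _ , _ , vb≢vc , _ , _) , e) =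
    rect va vb vc vd (InLevel⇒level h la) (InLevel⇒level h lb) (InLevel⇒level h lc)
      (InLevel⇒level h ld) e
    , vb≢vc

  Rect⇒Realizable : a < b → b ≤ c → c < d → (r : Rect h a b c d) → vb r ≢ vc r → Realizable h a b c d
  Rect⇒Realizable a<b b≤c c<d (rect va vb vc vd la lb lc ld e) vb≢vc =
    va , vb , vc , vd
    , level⇒InLevel h la , level⇒InLevel h lb , level⇒InLevel h lc , level⇒InLevel h ld
    , ( different-levels⇒≢ h la lb (<⇒≢ a<b)
      , different-levels⇒≢ h la lc (<⇒≢ a<c)
      , different-levels⇒≢ h la ld (<⇒≢ (<-trans a<c c<d))
      , vb≢vc
      , different-levels⇒≢ h lb ld (<⇒≢ (≤-<-trans b≤c c<d))
      , different-levels⇒≢ h lc ld (<⇒≢ c<d))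
    , e
    where
    a<c = <-≤-trans a<b b≤c

  Rect-∷ʳ : ∀ {a′ b′ c′ d′} g s t (r : Rect h a b c d) →
            a + weight g s ≡ a′ → b + weight g s ≡ b′ → c + weight g t ≡ c′ → d + weight g t ≡ d′ →
            Rect (h ∷ʳ g) a′ b′ c′ d′
  Rect-∷ʳ g s t (rect va vb vc vd la lb lc ld e) ea eb ec ed =
    rect (va ∷ʳ s) (vb ∷ʳ s) (vc ∷ʳ t) (vd ∷ʳ t)
      (append va s la ea) (append vb s lb eb) (append vc t lc ec) (append vd t ld ed)
      (trans (vsum-∷ʳ va vd s t) (trans (cong (_∷ʳ _) e) (sym (vsum-∷ʳ vb vc s t))))
    where
    append : ∀ v s {x x′} → level h v ≡ x → x + weight g s ≡ x′ → level (h ∷ʳ g) (v ∷ʳ s) ≡ x′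
    append v s lv ex = trans (level-∷ʳ h v g s) (trans (cong (_+ weight g s) lv) ex)

OrderedRect : ℕ → ℕ → ℕ → ℕ → ℕ → Set
OrderedRect N a b c d = a < b × b ≤ c × c < d × d + a ≡ b + c × d ≤ N

Primitive⇒Realizable : {h : Vec ℕ n} → Primitive h → OrderedRect (norm h) a b c d → Realizable h a b c d
Primitive⇒Realizable {b = b} {c = c} (real₃ , real₄) (a<b , b≤c , c<d , e , d≤N) with b ≟ c
... | yes b≡c = real₃ _ _ _ _ (a<b , b≡c , c<d , e , d≤N)
... | no  b≢c = real₄ _ _ _ _ (a<b , ≤∧≢⇒< b≤c b≢c , c<d , e , d≤N)

Realizable⇒Primitive : {h : Vec ℕ n} →
  (∀ {a b c d} → OrderedRect (norm h) a b c d → Realizable h a b c d) → Primitive h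
Realizable⇒Primitive real =
  (λ _ _ _ _ (a<b , b≡c , c<d , e , d≤N) → real (a<b , ≤-reflexive b≡c , c<d , e , d≤N)) ,
  (λ _ _ _ _ (a<b , b<c , c<d , e , d≤N) → real (a<b , <⇒≤ b<c , c<d , e , d≤N))

∸-+-exchange : g ≤ a → g ≤ d → a + b ≡ c + d → (a ∸ g) + b ≡ c + (d ∸ g)
∸-+-exchange {g} {a} {d} {b} {c} g≤a g≤d e = begin
  (a ∸ g) + b  ≡⟨ +-∸-comm b g≤a ⟨
  (a + b) ∸ g  ≡⟨ cong (_∸ g) e ⟩
  (c + d) ∸ g  ≡⟨ +-∸-assoc c g≤d ⟩
  c + (d ∸ g)  ∎
  where open ≡-Reasoning

+-exchange-< : s + p ≡ q + r → p < q → r < s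
+-exchange-< {s} {p} {q} {r} e p<q =
  +-cancelʳ-< p r s (subst (r + p <_) (trans (+-comm r q) (sym e)) (+-monoʳ-< r p<q))

≤-half : b ≤ c → b + c < suc d + suc d → b ≤ d
≤-half b≤c b+c<2+2d = ≮⇒≥ λ d<b → <⇒≱ b+c<2+2d (+-mono-≤ d<b (≤-trans d<b b≤c))

module _ (h : Vec ℕ n) (isPrimitive : Primitive h) where

  Rect-ordered : OrderedRect (norm h) a b c d → Σ[ r ∈ Rect h a b c d ] vb r ≢ vc r
  Rect-ordered R = Realizable⇒Rect (Primitive⇒Realizable {h = h} isPrimitive R)

  inner-level-has-two-vertices : a ≤ norm h → a ≢ 0 → a ≢ norm h →
                                 ∃[ v ] ∃[ w ] (v ≢ w × InLevel h a v × InLevel h a w)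
  inner-level-has-two-vertices {zero}  _   a≢0 _   = contradiction refl a≢0
  inner-level-has-two-vertices {suc a} a≤N _   a≢N
    with Primitive⇒Realizable {h = h} isPrimitive
           (≤-refl , ≤-refl , ≤-refl , sym (+-suc (suc a) a) , ≤∧≢⇒< a≤N a≢N)
  ... | _ , vb , vc , _ , _ , vb∈Sa , vc∈Sa , _ , (_ , _ , _ , vb≢vc , _ , _) , _ =
    vb , vc , vb≢vc , vb∈Sa , vc∈Sa

  level-surjective : a ≤ norm h → ∃[ v ] level h v ≡ a
  level-surjective {a} a≤N with a ≟ 0 | a ≟ norm h
  ... | yes refl | _        = replicate n true , level-replicate-true h
  ... | no _     | yes refl = replicate n false , level-replicate-false h
  ... | no a≢0   | no a≢N   with inner-level-has-two-vertices a≤N a≢0 a≢N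
  ...   | v , _ , _ , v∈Sa , _ = v , InLevel⇒level h v∈Sa

  Rect-sorted : p ≤ q → q ≤ r → s + p ≡ q + r → s ≤ norm h → Rect h p q r s
  Rect-sorted {p} {q} {r} {s} p≤q q≤r e s≤N with p ≟ q
  ... | no p≢q = proj₁ (Rect-ordered (p<q , q≤r , +-exchange-< e p<q , e , s≤N))
    where p<q = ≤∧≢⇒< p≤q p≢q
  ... | yes refl with +-cancelʳ-≡ p s r (trans e (+-comm p r))
  ...   | refl with level-surjective (≤-trans q≤r s≤N) | level-surjective s≤N
  ...     | x , level-x | y , level-y = rect x x y y level-x level-x level-y level-y refl

  Rect-min-first : p ≤ s → q ≤ r → s + p ≡ q + r → s ≤ norm h → r ≤ norm h → Rect h p q r s
  Rect-min-first {p} {s} {q} {r} p≤s q≤r e s≤N r≤N with p ≤? q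
  ... | yes p≤q = Rect-sorted p≤q q≤r e s≤N
  ... | no  p≰q = Rect-swapDiagonals
    (Rect-sorted (<⇒≤ (≰⇒> p≰q)) p≤s (trans (+-comm r q) (trans (sym e) (+-comm s p))) r≤N)

  Rect-any : s + p ≡ q + r → p ≤ norm h → q ≤ norm h → r ≤ norm h → s ≤ norm h → Rect h p q r s
  Rect-any {s} {p} {q} {r} e p≤N q≤N r≤N s≤N with ≤-total p s | ≤-total q r
  ... | inj₁ p≤s | inj₁ q≤r = Rect-min-first p≤s q≤r e s≤N r≤N
  ... | inj₁ p≤s | inj₂ r≤q = Rect-swapInner (Rect-min-first p≤s r≤q (trans e (+-comm q r)) s≤N q≤N)
  ... | inj₂ s≤p | inj₁ q≤r = Rect-swapOuter (Rect-min-first s≤p q≤r (trans (+-comm p s) e) p≤N r≤N)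
  ... | inj₂ s≤p | inj₂ r≤q = Rect-swapOuter (Rect-swapInner
    (Rect-min-first s≤p r≤q (trans (+-comm p s) (trans e (+-comm q r))) p≤N q≤N))

  Realizable-∷ʳ-uniform : ∀ s → weight g s ≤ a → OrderedRect (weight g s + norm h) a b c d →
                          Realizable (h ∷ʳ g) a b c d
  Realizable-∷ʳ-uniform {g} {a} {b} {c} {d} s w≤a (a<b , b≤c , c<d , e , d≤w+N) =
    Rect⇒Realizable a<b b≤c c<d
      (Rect-∷ʳ g s s (proj₁ realization) (m∸n+n≡m w≤a) (m∸n+n≡m w≤b) (m∸n+n≡m w≤c) (m∸n+n≡m w≤d))
      (λ eq → proj₂ realization (∷ʳ-injectiveˡ _ _ eq))
    where
    w = weight g s
    w≤b = ≤-trans w≤a (<⇒≤ a<b)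
    w≤c = ≤-trans w≤b b≤c
    w≤d = ≤-trans w≤c (<⇒≤ c<d)
    shifted : OrderedRect (norm h) (a ∸ w) (b ∸ w) (c ∸ w) (d ∸ w)
    shifted =
      ∸-monoˡ-< a<b w≤a , ∸-monoˡ-≤ w b≤c , ∸-monoˡ-< c<d w≤c ,
      sym (∸-+-exchange w≤b w≤a (sym (∸-+-exchange w≤d w≤c e))) ,
      m≤n+o⇒m∸n≤o d w d≤w+N
    realization = Rect-ordered shifted

  Realizable-∷ʳ-split : g ≤ c → b ≤ norm h → OrderedRect (g + norm h) a b c d →
                        Realizable (h ∷ʳ g) a b c d
  Realizable-∷ʳ-split {g} {c} {b} {a} {d} g≤c b≤N (a<b , b≤c , c<d , e , d≤g+N) =
    Rect⇒Realizable a<b b≤c c<d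
      (Rect-∷ʳ g true false base (+-identityʳ a) (+-identityʳ b) (m∸n+n≡m g≤c) (m∸n+n≡m g≤d))
      (λ eq → contradiction (∷ʳ-injectiveʳ _ _ eq) λ ())
    where
    g≤d = ≤-trans g≤c (<⇒≤ c<d)
    d∸g≤N = m≤n+o⇒m∸n≤o d g d≤g+N
    base = Rect-any (∸-+-exchange g≤d g≤c e) (≤-trans (<⇒≤ a<b) b≤N) b≤N
          (≤-trans (∸-monoˡ-≤ g (<⇒≤ c<d)) d∸g≤N) d∸g≤N

  Realizable-∷ʳ : 2 * g ≤ norm h + 2 → OrderedRect (g + norm h) a b c d → Realizable (h ∷ʳ g) a b c d
  Realizable-∷ʳ {g} {a} {b} {c} {d} 2g≤N+2 R@(a<b , b≤c , c<d , e , d≤g+N) with d ≤? norm h | g ≤? a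
  ... | yes d≤N | _       = Realizable-∷ʳ-uniform true z≤n (a<b , b≤c , c<d , e , d≤N)
  ... | no  _   | yes g≤a = Realizable-∷ʳ-uniform false g≤a R
  ... | no  d≰N | no  g≰a = Realizable-∷ʳ-split g≤c b≤N R
    where
    open ≤-Reasoning
    N = norm h
    g+g≤2+N : g + g ≤ 2 + N
    g+g≤2+N = begin
      g + g      ≡⟨ cong (_+_ g) (+-identityʳ g) ⟨
      2 * g      ≤⟨ 2g≤N+2 ⟩
      N + 2      ≡⟨ +-comm N 2 ⟩
      2 + N      ∎
    g≤c : g ≤ c
    g≤c = ≮⇒≥ λ c<g → d≰N (begin
      d              ≤⟨ m≤m+n d a ⟩
      d + a          ≡⟨ e ⟩
      b + c          ≤⟨ +-cancelˡ-≤ 2 (b + c) N (begin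
        2 + (b + c)    ≡⟨ cong suc (+-suc b c) ⟨
        suc b + suc c  ≤⟨ +-mono-≤ (≤-trans (s≤s b≤c) c<g) c<g ⟩
        g + g          ≤⟨ g+g≤2+N ⟩
        2 + N          ∎) ⟩
      N              ∎)
    b≤N : b ≤ N
    b≤N = ≤-half b≤c (begin-strict
      b + c          ≡⟨ e ⟨
      d + a          <⟨ +-mono-≤-< d≤g+N (≰⇒> g≰a) ⟩
      g + N + g      ≡⟨ xy∙z≈xz∙y g N g ⟩
      (g + g) + N    ≤⟨ +-monoˡ-≤ N g+g≤2+N ⟩
      2 + N + N      ≡⟨ cong suc (+-suc N N) ⟨
      suc N + suc N  ∎)

mainTheorem2 : ∀ (n : ℕ) (h : Vec ℕ n) → Primitive h →
    ((∀ (a : ℕ) → a ≤ norm h → ∃[ v ] InLevel h a v) ×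
     (∀ (a : ℕ) → a ≤ norm h → a ≢ 0 → a ≢ norm h →
        ∃[ v ] ∃[ w ] (v ≢ w × InLevel h a v × InLevel h a w))) ×
    (∀ (g : ℕ) → 2 * g ≤ norm h + 2 → Primitive (h ∷ʳ g))
mainTheorem2 n h isPrimitive =
  ( (λ a a≤N → map₂ (level⇒InLevel h) (level-surjective h isPrimitive a≤N))
  , (λ a → inner-level-has-two-vertices h isPrimitive) )
  , λ g 2g≤N+2 → Realizable⇒Primitive {h = h ∷ʳ g} λ {a} {b} {c} {d} R →
      Realizable-∷ʳ h isPrimitive 2g≤N+2 (subst (λ N → OrderedRect N a b c d) (norm-∷ʳ h g) R)
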